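{- Let $\Gamma$ be a graph with $n$ edges and $h_1>0$ independent cycles, let $d\geq1$, and let $q>2$ be a prime power. Assign to the $h_1$ independent cycles loop momenta $p_1,\dots,p_{h_1}\in\mathbb{F}_q^d$, and to each edge $i$ the momentum $k_i=\sum_j\varepsilon_{ij}p_j$ ($\varepsilon_{ij}\in\{ -1,0,1\}$) determined by momentum conservation. Let $Q$ be a polynomial of degree at most $2$ in $d$ variables over $\mathbb{F}_q$ (e.g. $Q(y)=\sum y_j^2+m^2$) and $Q_i(p)=Q(k_i(p))$. Define $$A(\Gamma)_{\mathbb{F}_q}=\sum_{p\in\mathbb{F}_q^{dh_1}:\ Q_i(p)\neq0\ \forall i}\ \frac{1}{\prod_{i=1}^nQ_i(p)}\in\mathbb{F}_q,$$ and let $c=dh_1-2n$ (the superficial degree of divergence). If $(q-1)c+2n>0$ then $A(\Gamma)_{\mathbb{F}_q}=0$. -}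

module Defs where

open import Level using (0ℓ)
open import Algebra.Bundles using (CommutativeRing)
open import Data.Nat using (ℕ; zero; suc)
open import Data.Fin using (Fin; zero; suc)
open import Data.List using (List; []; _∷_; map; concatMap; foldr; allFin)
open import Data.Bool using (Bool; true; false; if_then_else_; _∧_)
open import Data.Product using (∃)
open import Relation.Nullary using (¬_; Dec; yes; no)
open import Relation.Nullary.Decidable using (⌊_⌋)
open import Relation.Binary.PropositionalEquality using (_≡_)

-- Every finite field has prime-power order and conversely for each prime
-- power q there is a field of order q, so quantifying over such structures
-- with size > 2 = quantifying over F_q with q > 2 a prime power.
record FiniteField : Set₁ where
  field
    commRing : CommutativeRing 0ℓ 0ℓ
  open CommutativeRing commRing public
  field
    _≟_      : (x y : Carrier) → Dec (x ≈ y)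
    0≉1      : ¬ (0# ≈ 1#)
    _⁻¹      : Carrier → Carrier
    ⁻¹-inv   : ∀ x → ¬ (x ≈ 0#) → x * (x ⁻¹) ≈ 1#
    size     : ℕ
    enum     : Fin size → Carrier
    enum-inj : ∀ i j → enum i ≈ enum j → i ≡ j
    enum-sur : ∀ x → ∃ λ i → enum i ≈ x

funs : {A : Set} → List A → (m : ℕ) → List (Fin m → A)
funs xs zero    = (λ ()) ∷ []
funs xs (suc m) = concatMap (λ a → map (λ g → λ { zero → a ; (suc i) → g i }) (funs xs m)) xs

data Sign : Set where
  minus zer plus : Sign

module _ (F : FiniteField) where
  open FiniteField F using (Carrier; _+_; _*_; -_; 0#; 1#; _≟_; _⁻¹; enum; size)

  ∑ : (m : ℕ) → (Fin m → Carrier) → Carrier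
  ∑ zero    f = 0#
  ∑ (suc m) f = f zero + ∑ m (λ i → f (suc i))

  ∏ : (m : ℕ) → (Fin m → Carrier) → Carrier
  ∏ zero    f = 1#
  ∏ (suc m) f = f zero * ∏ m (λ i → f (suc i))

  elems : List Carrier
  elems = map enum (allFin size)

  ∑all : {A : Set} → List A → (A → Carrier) → Carrier
  ∑all xs f = foldr (λ a s → f a + s) 0# xs

  ⟦_⟧ : Sign → Carrier
  ⟦ minus ⟧ = - 1#
  ⟦ zer   ⟧ = 0#
  ⟦ plus  ⟧ = 1#

  record Quadric (d : ℕ) : Set where
    field
      a : Fin d → Fin d → Carrier
      b : Fin d → Carrier
      c : Carrier

  evalQ : {d : ℕ} → Quadric d → (Fin d → Carrier) → Carrier
  evalQ {d} Q y = ∑ d (λ j → ∑ d (λ l → a j l * y j * y l)) + ∑ d (λ j → b j * y j) + c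
    where open Quadric Q

  momentum : {n h₁ d : ℕ} → (Fin n → Fin h₁ → Sign) → (Fin h₁ → Fin d → Carrier)
           → Fin n → Fin d → Carrier
  momentum {n} {h₁} {d} ε p i t = ∑ h₁ (λ j → ⟦ ε i j ⟧ * p j t)

  Qᵢ : {n h₁ d : ℕ} → Quadric d → (Fin n → Fin h₁ → Sign) → (Fin h₁ → Fin d → Carrier)
     → Fin n → Carrier
  Qᵢ Q ε p i = evalQ Q (momentum ε p i)

  nonzero? : Carrier → Bool
  nonzero? x = if ⌊ x ≟ 0# ⌋ then false else true

  allNonzero : (n : ℕ) → (Fin n → Carrier) → Bool
  allNonzero zero    f = true
  allNonzero (suc n) f = nonzero? (f zero) ∧ allNonzero n (λ i → f (suc i))

  feynmanAmp : (n h₁ d : ℕ) → (Fin n → Fin h₁ → Sign) → Quadric d → Carrier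
  feynmanAmp n h₁ d ε Q =
    ∑all (funs (funs elems d) h₁) (λ p →
      if allNonzero n (Qᵢ Q ε p)
      then (∏ n (Qᵢ Q ε p)) ⁻¹
      else 0#)

module Submission where

-- For q > 2 and y ≠ 0 Fermat's little theorem gives y⁻¹ = y^(q-2), and
-- y^(q-2) = 0 for y = 0; hence the summand of A(Γ) at a loop momentum p is
-- ∏ᵢ Qᵢ(p)^(q-2) for every p.  This is a polynomial of degree ≤ 2n(q-2)
-- in the N = d·h₁ coordinates of p.  A polynomial of degree < N(q-1) sums
-- to zero over F^N (the sum lemma behind Chevalley–Warning): each of its
-- monomials is a product of one-variable power sums Σ_{x∈F} x^k, one of them
-- with k < q-1, and these vanish.  The hypothesis (q-1)c + 2n > 0 on the
-- superficial degree of divergence c = dh₁ - 2n is exactly 2n(q-2) < N(q-1).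

open import Defs
open import Level using (0ℓ)
open import Algebra.Bundles using (CommutativeMonoid; Semiring)
open import Data.Nat as ℕ using (ℕ; zero; suc; z≤n; s≤s; _∸_)
import Data.Nat.Properties as ℕP
open import Data.Fin using (Fin; zero; suc; punchIn)
import Data.Fin.Properties as FinP
open import Data.Fin.Permutation using (Permutation; permutation)
open import Data.Product using (∃; _×_; _,_; proj₁; proj₂)
open import Data.Sum using (_⊎_; inj₁; inj₂)
open import Data.Unit using (⊤; tt)
open import Data.Maybe using (nothing)
open import Data.Bool using (true; false; if_then_else_)
open import Data.Empty using (⊥-elim)
open import Data.List using (List; []; _∷_; _++_; length; tabulate; map; concatMap; allFin)
open import Data.List.Relation.Unary.All as All using (All; []; _∷_)
import Data.List.Relation.Unary.All.Properties as AllP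
open import Data.List.Relation.Unary.AllPairs using (AllPairs; []; _∷_)
import Data.List.Relation.Unary.Unique.Setoid.Properties as UniqueP
import Data.List.Properties as ListP
open import Function using (_∘_; Inverse; Congruent)
open import Relation.Nullary using (yes; no)
open import Relation.Nullary.Decidable using (¬?; _×-dec_)
open import Relation.Binary.PropositionalEquality as ≡ using (_≡_)
import Algebra.Properties.CommutativeMonoid.Sum as CommutativeMonoidSum
import Algebra.Solver.Ring as RingSolver
import Algebra.Solver.Ring.AlmostCommutativeRing as ACR
import Relation.Binary.Reasoning.Setoid as SetoidReasoning

module _ (F : FiniteField) where
  open FiniteField F hiding (zero)
  open SetoidReasoning setoid
  open import Algebra.Definitions.RawSemiring (Semiring.rawSemiring semiring) using (_^_)
  open import Algebra.Properties.Semiring.Exp semiring using (^-congˡ)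
  open import Algebra.Properties.CommutativeSemiring.Exp commutativeSemiring using (^-distrib-*)
  open import Algebra.Properties.Semiring.Sum semiring using (*-distribˡ-sum)
  open import Algebra.Properties.CommutativeSemigroup +-commutativeSemigroup
    using () renaming (interchange to +-interchange)
  open import Algebra.Properties.CommutativeSemigroup *-commutativeSemigroup
    using (x∙yz≈y∙xz) renaming (interchange to *-interchange)
  open import Algebra.Properties.Group +-group using (identityʳ-unique; x∙y⁻¹≈ε⇒x≈y)
  private
    module Σᶠ = CommutativeMonoidSum +-commutativeMonoid
    module Πᶠ = CommutativeMonoidSum *-commutativeMonoid
    almostRing : ACR.AlmostCommutativeRing 0ℓ 0ℓ
    almostRing = ACR.fromCommutativeRing commRing
    open RingSolver (ACR.AlmostCommutativeRing.rawRing almostRing) almostRing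
      (ACR.-raw-almostCommutative⟶ almostRing) (λ _ _ → nothing)
      using (solve; _:=_; _:+_; _:*_)

  *-cancelˡ : ∀ {x y z} → x ≉ 0# → x * y ≈ x * z → y ≈ z
  *-cancelˡ {x} {y} {z} x≉0 xy≈xz = begin
    y                 ≈⟨ *-identityˡ y ⟨
    1# * y            ≈⟨ *-congʳ (trans (*-comm _ _) (⁻¹-inv x x≉0)) ⟨
    (x ⁻¹ * x) * y    ≈⟨ *-assoc _ _ _ ⟩
    x ⁻¹ * (x * y)    ≈⟨ *-congˡ xy≈xz ⟩
    x ⁻¹ * (x * z)    ≈⟨ *-assoc _ _ _ ⟨
    (x ⁻¹ * x) * z    ≈⟨ *-congʳ (trans (*-comm _ _) (⁻¹-inv x x≉0)) ⟩
    1# * z            ≈⟨ *-identityˡ z ⟩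
    z                 ∎

  *-cancelʳ : ∀ {x y z} → z ≉ 0# → x * z ≈ y * z → x ≈ y
  *-cancelʳ {x} {y} {z} z≉0 xz≈yz =
    *-cancelˡ z≉0 (trans (*-comm z x) (trans xz≈yz (*-comm y z)))

  *-nonzero : ∀ {x y} → x ≉ 0# → y ≉ 0# → x * y ≉ 0#
  *-nonzero {x} x≉0 y≉0 xy≈0 = y≉0 (*-cancelˡ x≉0 (trans xy≈0 (sym (zeroʳ x))))

  ⁻¹-unique : ∀ {x y} → x ≉ 0# → x * y ≈ 1# → x ⁻¹ ≈ y
  ⁻¹-unique {x} x≉0 xy≈1 = *-cancelˡ x≉0 (trans (⁻¹-inv x x≉0) (sym xy≈1))

  fixed-by-scaling : ∀ {u s} → u ≉ 1# → u * s ≈ s → s ≈ 0#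
  fixed-by-scaling {u} {s} u≉1 us≈s with s ≟ 0#
  ... | yes s≈0 = s≈0
  ... | no  s≉0 = ⊥-elim (u≉1 (*-cancelʳ s≉0 (trans us≈s (sym (*-identityˡ s)))))

  record Enumeration (n : ℕ) : Set where
    field
      point            : Fin n → Carrier
      point-injective  : ∀ i j → point i ≈ point j → i ≡ j
      point-surjective : ∀ x → ∃ λ i → point i ≈ x

    index : Carrier → Fin n
    index x = proj₁ (point-surjective x)

    point-index : ∀ x → point (index x) ≈ x
    point-index x = proj₂ (point-surjective x)

  fieldEnumeration : Enumeration size
  fieldEnumeration = record
    { point = enum ; point-injective = enum-inj ; point-surjective = enum-sur }

  CarrierBijection : Set
  CarrierBijection = Inverse setoid setoid

  mkBijection : (σ τ : Carrier → Carrier) →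
                (∀ {x y} → x ≈ y → σ x ≈ σ y) → (∀ {x y} → x ≈ y → τ x ≈ τ y) →
                (∀ x → σ (τ x) ≈ x) → (∀ x → τ (σ x) ≈ x) → CarrierBijection
  mkBijection σ τ σ-cong τ-cong στ τσ = record
    { to = σ ; from = τ ; to-cong = σ-cong ; from-cong = τ-cong
    ; inverse = (λ {x} y≈τx → trans (σ-cong y≈τx) (στ x))
              , (λ {x} y≈σx → trans (τ-cong y≈σx) (τσ x)) }

  translation : Carrier → CarrierBijection
  translation c = mkBijection (_+ c) (_- c) +-congʳ +-congʳ
    (λ x → begin
      (x - c) + c   ≈⟨ +-assoc _ _ _ ⟩
      x + (- c + c) ≈⟨ +-congˡ (-‿inverseˡ c) ⟩
      x + 0#        ≈⟨ +-identityʳ x ⟩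
      x             ∎)
    (λ x → begin
      (x + c) - c   ≈⟨ +-assoc _ _ _ ⟩
      x + (c - c)   ≈⟨ +-congˡ (-‿inverseʳ c) ⟩
      x + 0#        ≈⟨ +-identityʳ x ⟩
      x             ∎)

  scaling : ∀ u → u ≉ 0# → CarrierBijection
  scaling u u≉0 = mkBijection (u *_) (u ⁻¹ *_) *-congˡ *-congˡ
    (λ x → begin
      u * (u ⁻¹ * x)  ≈⟨ *-assoc _ _ _ ⟨
      (u * u ⁻¹) * x  ≈⟨ *-congʳ (⁻¹-inv u u≉0) ⟩
      1# * x          ≈⟨ *-identityˡ x ⟩
      x               ∎)
    (λ x → begin
      u ⁻¹ * (u * x)  ≈⟨ *-assoc _ _ _ ⟨
      (u ⁻¹ * u) * x  ≈⟨ *-congʳ (trans (*-comm _ _) (⁻¹-inv u u≉0)) ⟩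
      1# * x          ≈⟨ *-identityˡ x ⟩
      x               ∎)

  -- A bijection of the field permutes the points of any enumeration, so sums
  -- (in any commutative monoid) over the field are invariant under it.
  module _ {n} (E : Enumeration n) (σ : CarrierBijection) where
    open Enumeration E
    open Inverse σ using (to; from; to-cong; from-cong; strictlyInverseˡ; strictlyInverseʳ)

    inducedPermutation : Permutation n n
    inducedPermutation = permutation (λ i → index (to (point i))) (λ i → index (from (point i)))
      (λ i → point-injective _ _
        (trans (point-index _) (trans (to-cong (point-index _)) (strictlyInverseˡ _))))
      (λ i → point-injective _ _
        (trans (point-index _) (trans (from-cong (point-index _)) (strictlyInverseʳ _))))

    sum-invariant : (M : CommutativeMonoid 0ℓ 0ℓ) (f : Carrier → CommutativeMonoid.Carrier M) →
                    Congruent _≈_ (CommutativeMonoid._≈_ M) f →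
                    CommutativeMonoid._≈_ M (CommutativeMonoidSum.sum M (f ∘ point))
                                            (CommutativeMonoidSum.sum M (f ∘ to ∘ point))
    sum-invariant M f f-cong = M.trans (sum-permute (f ∘ point) inducedPermutation)
                                       (sum-cong-≋ {n} (λ i → f-cong (point-index (to (point i)))))
      where module M = CommutativeMonoid M
            open CommutativeMonoidSum M using (sum-permute; sum-cong-≋)

  unitPart : Carrier → Carrier
  unitPart y with y ≟ 0#
  ... | yes _ = 1#
  ... | no  _ = y

  unitPart-cong : ∀ {x y} → x ≈ y → unitPart x ≈ unitPart y
  unitPart-cong {x} {y} x≈y with x ≟ 0# | y ≟ 0#
  ... | yes _   | yes _   = refl
  ... | yes x≈0 | no  y≉0 = ⊥-elim (y≉0 (trans (sym x≈y) x≈0))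
  ... | no  x≉0 | yes y≈0 = ⊥-elim (x≉0 (trans x≈y y≈0))
  ... | no  _   | no  _   = x≈y

  unitPart-nonzero : ∀ y → unitPart y ≉ 0#
  unitPart-nonzero y with y ≟ 0#
  ... | yes _   = λ 1≈0 → 0≉1 (sym 1≈0)
  ... | no  y≉0 = y≉0

  unitPart-scaling : ∀ {x} → x ≉ 0# → ∀ y →
                     unitPart (x * y) ≈ (if nonzero? F y then x else 1#) * unitPart y
  unitPart-scaling {x} x≉0 y with y ≟ 0# | (x * y) ≟ 0#
  ... | yes _   | yes _    = sym (*-identityˡ 1#)
  ... | yes y≈0 | no  xy≉0 = ⊥-elim (xy≉0 (trans (*-congˡ y≈0) (zeroʳ x)))
  ... | no  y≉0 | yes xy≈0 = ⊥-elim (*-nonzero x≉0 y≉0 xy≈0)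
  ... | no  _   | no  _    = refl

  nonzero?-zero : ∀ {y} → y ≈ 0# → nonzero? F y ≡ false
  nonzero?-zero {y} y≈0 with y ≟ 0#
  ... | yes _   = ≡.refl
  ... | no  y≉0 = ⊥-elim (y≉0 y≈0)

  nonzero?-nonzero : ∀ {y} → y ≉ 0# → nonzero? F y ≡ true
  nonzero?-nonzero {y} y≉0 with y ≟ 0#
  ... | yes y≈0 = ⊥-elim (y≉0 y≈0)
  ... | no  _   = ≡.refl

  product-nonzero : ∀ {k} (f : Fin k → Carrier) → (∀ i → f i ≉ 0#) → Πᶠ.sum f ≉ 0#
  product-nonzero {zero}  f f≉0 = λ 1≈0 → 0≉1 (sym 1≈0)
  product-nonzero {suc k} f f≉0 = *-nonzero (f≉0 zero) (product-nonzero (f ∘ suc) (f≉0 ∘ suc))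

  -- Fermat's little theorem: in a field with n elements, x^(n-1) = 1 for x ≠ 0.
  -- The product P of unitPart over the field is nonzero and invariant under
  -- y ↦ x * y, while this substitution multiplies it by x^(n-1).
  fermat : ∀ {n} → Enumeration n → ∀ x → x ≉ 0# → x ^ (n ∸ 1) ≈ 1#
  fermat {zero} E x _ with Enumeration.index E 0#
  ... | ()
  fermat {suc m} E x x≉0 = *-cancelʳ (product-nonzero (unitPart ∘ point) (unitPart-nonzero ∘ point)) (begin
    x ^ m * P
      ≈⟨ *-congʳ factor-product ⟨
    Πᶠ.sum (factor ∘ point) * P
      ≈⟨ Πᶠ.∑-distrib-+ (factor ∘ point) (unitPart ∘ point) ⟨
    Πᶠ.sum (λ i → factor (point i) * unitPart (point i))
      ≈⟨ Πᶠ.sum-cong-≋ (unitPart-scaling x≉0 ∘ point) ⟨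
    Πᶠ.sum (λ i → unitPart (x * point i))
      ≈⟨ sum-invariant E (scaling x x≉0) *-commutativeMonoid unitPart unitPart-cong ⟨
    P
      ≈⟨ *-identityˡ P ⟨
    1# * P ∎)
    where
    open Enumeration E
    P : Carrier
    P = Πᶠ.sum (unitPart ∘ point)

    -- the ratio unitPart (x * y) / unitPart y
    factor : Carrier → Carrier
    factor y = if nonzero? F y then x else 1#

    punched-nonzero : ∀ j → point (punchIn (index 0#) j) ≉ 0#
    punched-nonzero j p≈0 = FinP.punchInᵢ≢i (index 0#) j
      (point-injective _ _ (trans p≈0 (sym (point-index 0#))))

    -- factor is 1 at the point 0 and x at the other m points
    factor-product : Πᶠ.sum (factor ∘ point) ≈ x ^ m
    factor-product = begin
      Πᶠ.sum (factor ∘ point)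
        ≈⟨ Πᶠ.sum-remove {i = index 0#} (factor ∘ point) ⟩
      factor (point (index 0#)) * Πᶠ.sum (factor ∘ point ∘ punchIn (index 0#))
        ≈⟨ *-cong (reflexive (≡.cong (if_then x else 1#) (nonzero?-zero (point-index 0#))))
                  (Πᶠ.sum-cong-≋ {m} (λ j → reflexive
                    (≡.cong (if_then x else 1#) (nonzero?-nonzero (punched-nonzero j))))) ⟩
      1# * Πᶠ.sum {m} (λ _ → x)
        ≈⟨ *-identityˡ _ ⟩
      Πᶠ.sum {m} (λ _ → x)
        ≈⟨ Πᶠ.sum-replicate m ⟩
      x ^ m ∎

  -- Polynomials in one variable as ascending coefficient lists (Horner evaluation).
  horner : List Carrier → Carrier → Carrier
  horner []       x = 0#
  horner (c ∷ cs) x = c + x * horner cs x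

  leading : List Carrier → Carrier
  leading []           = 0#
  leading (c ∷ [])     = c
  leading (c ∷ d ∷ cs) = leading (d ∷ cs)

  -- Synthetic division by X - r: writing x = r + δ,
  -- c + x·g(x) = (c + r·g(r)) + δ·(quotient r g)(x).
  quotient : Carrier → List Carrier → List Carrier
  quotient r []       = []
  quotient r (d ∷ cs) = horner (d ∷ cs) r ∷ quotient r cs

  division : ∀ r c g {x δ} → x ≈ r + δ →
             horner (c ∷ g) x ≈ horner (c ∷ g) r + δ * horner (quotient r g) x
  division r c [] {x} {δ} _ = begin
    c + x * 0#              ≈⟨ +-congˡ (trans (zeroʳ x) (sym (zeroʳ r))) ⟩
    c + r * 0#              ≈⟨ +-identityʳ _ ⟨
    (c + r * 0#) + 0#       ≈⟨ +-congˡ (zeroʳ δ) ⟨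
    (c + r * 0#) + δ * 0#   ∎
  division r c (d ∷ g) {x} {δ} x≈r+δ = begin
    c + x * horner (d ∷ g) x
      ≈⟨ +-congˡ (*-cong x≈r+δ (division r d g x≈r+δ)) ⟩
    c + (r + δ) * (gr + δ * qx)
      ≈⟨ solve 5 (λ c r δ gr qx → c :+ (r :+ δ) :* (gr :+ δ :* qx)
                                := (c :+ r :* gr) :+ δ :* (gr :+ (r :+ δ) :* qx)) refl c r δ gr qx ⟩
    (c + r * gr) + δ * (gr + (r + δ) * qx)
      ≈⟨ +-congˡ (*-congˡ (+-congˡ (*-congʳ x≈r+δ))) ⟨
    (c + r * gr) + δ * (gr + x * qx) ∎
    where
    gr qx : Carrier
    gr = horner (d ∷ g) r
    qx = horner (quotient r g) x

  length-quotient : ∀ r g → length (quotient r g) ≡ length g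
  length-quotient r []      = ≡.refl
  length-quotient r (d ∷ g) = ≡.cong suc (length-quotient r g)

  leading-quotient : ∀ r d g → leading (quotient r (d ∷ g)) ≈ leading (d ∷ g)
  leading-quotient r d []      = trans (+-congˡ (zeroʳ r)) (+-identityʳ d)
  leading-quotient r d (e ∷ g) = leading-quotient r e g

  -- A polynomial with at least as many distinct roots as coefficients has
  -- vanishing leading coefficient (one root is divided out at a time).
  root-bound : ∀ cs rs → length cs ℕ.≤ length rs → AllPairs _≉_ rs →
               All (λ r → horner cs r ≈ 0#) rs → leading cs ≈ 0#
  root-bound []           rs       _         _                   _          = refl
  root-bound (c ∷ [])     (r ∷ rs) _         _                   (cr≈0 ∷ _) =
    trans (sym (trans (+-congˡ (zeroʳ r)) (+-identityʳ c))) cr≈0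
  root-bound (c ∷ d ∷ g) (r ∷ rs) (s≤s len≤) (r≉rs ∷ distinct) (cr≈0 ∷ roots) =
    trans (sym (leading-quotient r d g))
      (root-bound (quotient r (d ∷ g)) rs
                  (≡.subst (ℕ._≤ length rs) (≡.sym (length-quotient r (d ∷ g))) len≤)
                  distinct (All.zipWith quotient-root (r≉rs , roots)))
    where
    quotient-root : ∀ {s} → r ≉ s × horner (c ∷ d ∷ g) s ≈ 0# → horner (quotient r (d ∷ g)) s ≈ 0#
    quotient-root {s} (r≉s , cs≈0) = *-cancelˡ s-r≉0 (begin
      (s - r) * horner (quotient r (d ∷ g)) s                          ≈⟨ +-identityˡ _ ⟨
      0# + (s - r) * horner (quotient r (d ∷ g)) s                     ≈⟨ +-congʳ cr≈0 ⟨
      horner (c ∷ d ∷ g) r + (s - r) * horner (quotient r (d ∷ g)) s   ≈⟨ division r c (d ∷ g) s≈r+[s-r] ⟨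
      horner (c ∷ d ∷ g) s                                             ≈⟨ cs≈0 ⟩
      0#                                                               ≈⟨ zeroʳ _ ⟨
      (s - r) * 0#                                                     ∎)
      where
      s≈r+[s-r] : s ≈ r + (s - r)
      s≈r+[s-r] = begin
        s            ≈⟨ +-identityˡ s ⟨
        0# + s       ≈⟨ +-congʳ (-‿inverseʳ r) ⟨
        (r - r) + s  ≈⟨ +-assoc r (- r) s ⟩
        r + (- r + s) ≈⟨ +-congˡ (+-comm (- r) s) ⟩
        r + (s - r)  ∎
      s-r≉0 : s - r ≉ 0#
      s-r≉0 s-r≈0 = r≉s (sym (x∙y⁻¹≈ε⇒x≈y s r s-r≈0))

  monomialX : ℕ → List Carrier
  monomialX zero    = 1# ∷ []
  monomialX (suc j) = 0# ∷ monomialX j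

  horner-monomialX : ∀ j x → horner (monomialX j) x ≈ x ^ j
  horner-monomialX zero    x = trans (+-congˡ (zeroʳ x)) (+-identityʳ 1#)
  horner-monomialX (suc j) x = trans (+-identityˡ _) (*-congˡ (horner-monomialX j x))

  length-monomialX : ∀ j → length (monomialX j) ≡ suc j
  length-monomialX zero    = ≡.refl
  length-monomialX (suc j) = ≡.cong suc (length-monomialX j)

  leading-monomialX : ∀ c j → leading (c ∷ monomialX j) ≡ 1#
  leading-monomialX c zero    = ≡.refl
  leading-monomialX c (suc j) = leading-monomialX 0# j

  -- For 0 < k < n - 1 some nonzero u has u^k ≠ 1: otherwise all n elements of
  -- the field would be roots of X^(k+1) - X, which has only k + 2 coefficients.
  non-root : ∀ {n} → Enumeration n → ∀ j → suc j ℕ.< n ∸ 1 → ∃ λ u → u ≉ 0# × u ^ suc j ≉ 1#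
  non-root {suc m} E j j<m
    with FinP.any? (λ i → ¬? (Enumeration.point E i ≟ 0#)
                    ×-dec ¬? ((Enumeration.point E i ^ suc j) ≟ 1#))
  ... | yes (i , nonzero , non-root) = Enumeration.point E i , nonzero , non-root
  ... | no  no-witness = ⊥-elim (0≉1 (begin
    0#          ≈⟨ root-bound cs (tabulate point) enough-roots
                     (UniqueP.tabulate⁺ setoid (λ {i} {j} → point-injective i j))
                     (AllP.tabulate⁺ every-point-is-root) ⟨
    leading cs  ≡⟨ leading-monomialX (- 1#) j ⟩
    1#          ∎))
    where
    open Enumeration E
    -- X^(k+1) - X with k = suc j
    cs : List Carrier
    cs = 0# ∷ - 1# ∷ monomialX j

    enough-roots : length cs ℕ.≤ length (tabulate point)
    enough-roots rewrite length-monomialX j | ListP.length-tabulate point = s≤s j<m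

    every-point-is-root : ∀ i → horner cs (point i) ≈ 0#
    every-point-is-root i with point i ≟ 0# | (point i ^ suc j) ≟ 1#
    ... | yes x≈0 | _ = trans (+-identityˡ _) (trans (*-congʳ x≈0) (zeroˡ _))
    ... | no  x≉0 | no  xᵏ≉1 = ⊥-elim (no-witness (i , x≉0 , xᵏ≉1))
    ... | no  _   | yes xᵏ≈1 = begin
      0# + x * (- 1# + x * horner (monomialX j) x)  ≈⟨ +-identityˡ _ ⟩
      x * (- 1# + x * horner (monomialX j) x)       ≈⟨ *-congˡ (+-congˡ (*-congˡ (horner-monomialX j x))) ⟩
      x * (- 1# + x ^ suc j)                        ≈⟨ *-congˡ (+-congˡ xᵏ≈1) ⟩
      x * (- 1# + 1#)                               ≈⟨ *-congˡ (-‿inverseˡ 1#) ⟩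
      x * 0#                                        ≈⟨ zeroʳ x ⟩
      0#                                            ∎
      where
      x : Carrier
      x = point i

  -- Power sums: Σ_{x ∈ F} x^k = 0 for k < n - 1.  For k = 0 this follows from
  -- invariance under x ↦ x + 1; for k > 0 from invariance under x ↦ u·x with
  -- u^k ≠ 1.
  power-sum : ∀ {n} (E : Enumeration n) k → k ℕ.< n ∸ 1 →
              Σᶠ.sum (λ i → Enumeration.point E i ^ k) ≈ 0#
  power-sum E zero _ = identityʳ-unique S (Σᶠ.sum (λ i → point i ^ 0)) (sym (begin
    S                               ≈⟨ sum-invariant E (translation 1#) +-commutativeMonoid (λ x → x) (λ x≈y → x≈y) ⟩
    Σᶠ.sum (λ i → point i + 1#)     ≈⟨ Σᶠ.∑-distrib-+ point (λ _ → 1#) ⟩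
    S + Σᶠ.sum (λ i → point i ^ 0)  ∎))
    where
    open Enumeration E
    S : Carrier
    S = Σᶠ.sum point
  power-sum E (suc j) j<n-1 with non-root E j j<n-1
  ... | u , u≉0 , uᵏ≉1 = fixed-by-scaling uᵏ≉1 (sym (begin
    S                                   ≈⟨ sum-invariant E (scaling u u≉0) +-commutativeMonoid (_^ k) (^-congˡ k) ⟩
    Σᶠ.sum (λ i → (u * point i) ^ k)    ≈⟨ Σᶠ.sum-cong-≋ (λ i → ^-distrib-* u (point i) k) ⟩
    Σᶠ.sum (λ i → u ^ k * point i ^ k)  ≈⟨ *-distribˡ-sum (u ^ k) (λ i → point i ^ k) ⟨
    u ^ k * S                           ∎))
    where
    open Enumeration E
    k : ℕ
    k = suc j
    S : Carrier
    S = Σᶠ.sum (λ i → point i ^ k)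

  sumOver : {A : Set} → List A → (A → Carrier) → Carrier
  sumOver = ∑all F

  sumOver-cong : ∀ {A : Set} (xs : List A) {f g : A → Carrier} →
                 (∀ a → f a ≈ g a) → sumOver xs f ≈ sumOver xs g
  sumOver-cong []       f≈g = refl
  sumOver-cong (x ∷ xs) f≈g = +-cong (f≈g x) (sumOver-cong xs f≈g)

  sumOver-++ : ∀ {A : Set} (xs ys : List A) (f : A → Carrier) →
               sumOver (xs ++ ys) f ≈ sumOver xs f + sumOver ys f
  sumOver-++ []       ys f = sym (+-identityˡ _)
  sumOver-++ (x ∷ xs) ys f = trans (+-congˡ (sumOver-++ xs ys f)) (sym (+-assoc _ _ _))

  sumOver-map : ∀ {A B : Set} (h : A → B) (xs : List A) (f : B → Carrier) →
                sumOver (map h xs) f ≡ sumOver xs (f ∘ h)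
  sumOver-map h []       f = ≡.refl
  sumOver-map h (x ∷ xs) f = ≡.cong (f (h x) +_) (sumOver-map h xs f)

  sumOver-+ : ∀ {A : Set} (xs : List A) (f g : A → Carrier) →
              sumOver xs (λ a → f a + g a) ≈ sumOver xs f + sumOver xs g
  sumOver-+ []       f g = sym (+-identityˡ _)
  sumOver-+ (x ∷ xs) f g = trans (+-congˡ (sumOver-+ xs f g)) (+-interchange (f x) (g x) _ _)

  sumOver-*ˡ : ∀ {A : Set} (xs : List A) c (f : A → Carrier) →
               sumOver xs (λ a → c * f a) ≈ c * sumOver xs f
  sumOver-*ˡ []       c f = sym (zeroʳ c)
  sumOver-*ˡ (x ∷ xs) c f = trans (+-congˡ (sumOver-*ˡ xs c f)) (sym (distribˡ c _ _))

  sumOver-vanishes : ∀ {A : Set} (xs : List A) {f : A → Carrier} →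
                     (∀ a → f a ≈ 0#) → sumOver xs f ≈ 0#
  sumOver-vanishes []       f≈0 = refl
  sumOver-vanishes (x ∷ xs) f≈0 = trans (+-cong (f≈0 x) (sumOver-vanishes xs f≈0)) (+-identityˡ 0#)

  sumOver-swap : ∀ {A B : Set} (xs : List A) (ys : List B) (f : A → B → Carrier) →
                 sumOver xs (λ a → sumOver ys (f a)) ≈ sumOver ys (λ b → sumOver xs (λ a → f a b))
  sumOver-swap []       ys f = sym (sumOver-vanishes ys (λ _ → refl))
  sumOver-swap (x ∷ xs) ys f =
    trans (+-congˡ (sumOver-swap xs ys f))
          (sym (sumOver-+ ys (f x) (λ b → sumOver xs (λ a → f a b))))

  sumOver-combinations : ∀ {A B C : Set} (xs : List A) (ys : List B) (_⊙_ : A → B → C)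
                         (h : C → Carrier) (f : A → Carrier) (g : B → Carrier) →
                         (∀ a b → h (a ⊙ b) ≈ f a * g b) →
                         sumOver (concatMap (λ a → map (a ⊙_) ys) xs) h ≈ sumOver xs f * sumOver ys g
  sumOver-combinations []       ys _⊙_ h f g factorises = sym (zeroˡ _)
  sumOver-combinations {C = C} (x ∷ xs) ys _⊙_ h f g factorises = begin
    sumOver (map (x ⊙_) ys ++ rest) h
      ≈⟨ sumOver-++ (map (x ⊙_) ys) rest h ⟩
    sumOver (map (x ⊙_) ys) h + sumOver rest h
      ≈⟨ +-cong (reflexive (sumOver-map (x ⊙_) ys h)) (sumOver-combinations xs ys _⊙_ h f g factorises) ⟩
    sumOver ys (λ b → h (x ⊙ b)) + sumOver xs f * G
      ≈⟨ +-congʳ (trans (sumOver-cong ys (factorises x)) (sumOver-*ˡ ys (f x) g)) ⟩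
    f x * G + sumOver xs f * G
      ≈⟨ distribʳ G (f x) (sumOver xs f) ⟨
    (f x + sumOver xs f) * G ∎
    where
    rest : List C
    rest = concatMap (λ a → map (a ⊙_) ys) xs
    G : Carrier
    G = sumOver ys g

  sumOver-enumeration : ∀ {B : Set} n (g : Fin n → B) (f : B → Carrier) →
                        sumOver (map g (allFin n)) f ≈ Σᶠ.sum (f ∘ g)
  sumOver-enumeration n g f = trans (reflexive (sumOver-map g (allFin n) f)) (tabulated n (λ i → i))
    where
    tabulated : ∀ k (h : Fin k → Fin n) → sumOver (tabulate h) (f ∘ g) ≈ Σᶠ.sum (f ∘ g ∘ h)
    tabulated zero    h = refl
    tabulated (suc k) h = +-congˡ (tabulated k (h ∘ suc))

  monomial : {V : Set} → List V → (V → Carrier) → Carrier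
  monomial []      val = 1#
  monomial (v ∷ μ) val = val v * monomial μ val

  monomial-++ : ∀ {V : Set} (μ ν : List V) val →
                monomial (μ ++ ν) val ≈ monomial μ val * monomial ν val
  monomial-++ []      ν val = sym (*-identityˡ _)
  monomial-++ (v ∷ μ) ν val = trans (*-congˡ (monomial-++ μ ν val)) (sym (*-assoc _ _ _))

  q-1 : ℕ
  q-1 = size ∸ 1

  -- A grid is a finite list of points with coordinates indexed by Var on
  -- which every monomial of degree below dim·(q - 1) sums to zero; the
  -- basic example is F^dim with its coordinate functions.
  record Grid : Set₁ where
    field
      Point  : Set
      points : List Point
      Var    : Set
      coord  : Point → Var → Carrier
      dim    : ℕ
      monomial-sum : ∀ (μ : List Var) → length μ ℕ.< dim ℕ.* q-1 →
                     sumOver points (λ p → monomial μ (coord p)) ≈ 0#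

  -- The field itself, with one coordinate: its monomial sums are the power sums.
  lineGrid : Grid
  lineGrid = record
    { Point = Carrier ; points = elems F ; Var = ⊤ ; coord = λ a _ → a ; dim = 1
    ; monomial-sum = λ μ μ<q-1 → begin
        sumOver (elems F) (λ a → monomial μ (λ _ → a))
          ≈⟨ sumOver-enumeration size enum (λ a → monomial μ (λ _ → a)) ⟩
        Σᶠ.sum (λ i → monomial μ (λ _ → enum i))
          ≈⟨ Σᶠ.sum-cong-≋ (λ i → monomial-constant μ (enum i)) ⟩
        Σᶠ.sum (λ i → enum i ^ length μ)
          ≈⟨ power-sum fieldEnumeration (length μ) (≡.subst (length μ ℕ.<_) (ℕP.+-identityʳ q-1) μ<q-1) ⟩
        0# ∎ }
    where
    monomial-constant : ∀ (μ : List ⊤) a → monomial μ (λ _ → a) ≈ a ^ length μ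
    monomial-constant []      a = refl
    monomial-constant (_ ∷ μ) a = *-congˡ (monomial-constant μ a)

  -- Separating the variables of the first factor of G^(k+1) = G × G^k.
  splitVars : ∀ {V : Set} {k} → List (Fin (suc k) × V) → List V × List (Fin k × V)
  splitVars []                = [] , []
  splitVars ((zero  , v) ∷ μ) = v ∷ proj₁ (splitVars μ) , proj₂ (splitVars μ)
  splitVars ((suc i , v) ∷ μ) = proj₁ (splitVars μ) , (i , v) ∷ proj₂ (splitVars μ)

  length-splitVars : ∀ {V : Set} {k} (μ : List (Fin (suc k) × V)) →
                     length μ ≡ length (proj₁ (splitVars μ)) ℕ.+ length (proj₂ (splitVars μ))
  length-splitVars []                = ≡.refl
  length-splitVars ((zero  , v) ∷ μ) = ≡.cong suc (length-splitVars μ)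
  length-splitVars ((suc i , v) ∷ μ) =
    ≡.trans (≡.cong suc (length-splitVars μ)) (≡.sym (ℕP.+-suc _ _))

  monomial-splitVars : ∀ {V : Set} {k} (μ : List (Fin (suc k) × V)) (val : Fin (suc k) × V → Carrier) →
                       monomial μ val ≈ monomial (proj₁ (splitVars μ)) (λ v → val (zero , v))
                                      * monomial (proj₂ (splitVars μ)) (λ { (i , v) → val (suc i , v) })
  monomial-splitVars []                val = sym (*-identityˡ 1#)
  monomial-splitVars ((zero  , v) ∷ μ) val =
    trans (*-congˡ (monomial-splitVars μ val)) (sym (*-assoc _ _ _))
  monomial-splitVars ((suc i , v) ∷ μ) val =
    trans (*-congˡ (monomial-splitVars μ val)) (x∙yz≈y∙xz _ _ _)

  +-<-split : ∀ {a b c d} → a ℕ.+ b ℕ.< c ℕ.+ d → a ℕ.< c ⊎ b ℕ.< d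
  +-<-split {a} {b} {c} {d} a+b<c+d with a ℕ.<? c
  ... | yes a<c = inj₁ a<c
  ... | no  a≮c = inj₂ (ℕP.+-cancelˡ-< c b d
                         (ℕP.≤-<-trans (ℕP.+-monoˡ-≤ b (ℕP.≮⇒≥ a≮c)) a+b<c+d))

  -- A monomial of low degree splits into a monomial on the first factor and
  -- one on the remaining k - 1 factors, and one of them has low degree.
  _^ᴳ_ : Grid → ℕ → Grid
  G ^ᴳ k = record
    { Point = Fin k → Point ; points = funs points k ; Var = Fin k × Var
    ; coord = λ p → λ { (i , v) → coord (p i) v } ; dim = k ℕ.* dim
    ; monomial-sum = power-monomial-sum k }
    where
    open Grid G
    power-monomial-sum : ∀ k (μ : List (Fin k × Var)) → length μ ℕ.< (k ℕ.* dim) ℕ.* q-1 →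
                         sumOver (funs points k) (λ p → monomial μ (λ { (i , v) → coord (p i) v })) ≈ 0#
    power-monomial-sum zero    μ ()
    power-monomial-sum (suc k) μ μ<dim = begin
      sumOver (funs points (suc k)) (λ p → monomial μ (λ { (i , v) → coord (p i) v }))
        ≈⟨ sumOver-combinations points (funs points k) _ _ first rest (λ a g → monomial-splitVars μ _) ⟩
      sumOver points first * sumOver (funs points k) rest
        ≈⟨ one-factor-vanishes (+-<-split (≡.subst₂ ℕ._<_ (length-splitVars μ)
                                                          (ℕP.*-distribʳ-+ q-1 dim (k ℕ.* dim)) μ<dim)) ⟩
      0# ∎
      where
      μ₀ : List Var
      μ₀ = proj₁ (splitVars μ)
      μ₁ : List (Fin k × Var)
      μ₁ = proj₂ (splitVars μ)
      first : Point → Carrier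
      first a = monomial μ₀ (coord a)
      rest : (Fin k → Point) → Carrier
      rest g = monomial μ₁ (λ { (i , v) → coord (g i) v })
      one-factor-vanishes : length μ₀ ℕ.< dim ℕ.* q-1 ⊎ length μ₁ ℕ.< (k ℕ.* dim) ℕ.* q-1 →
                            sumOver points first * sumOver (funs points k) rest ≈ 0#
      one-factor-vanishes (inj₁ μ₀<) = trans (*-congʳ (monomial-sum μ₀ μ₀<)) (zeroˡ _)
      one-factor-vanishes (inj₂ μ₁<) = trans (*-congˡ (power-monomial-sum k μ₁ μ₁<)) (zeroʳ _)

  record Term (V : Set) (D : ℕ) : Set where
    constructor term
    field
      coeff   : Carrier
      vars    : List V
      degree≤ : length vars ℕ.≤ D

  Poly : Set → ℕ → Set
  Poly V D = List (Term V D)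

  module _ {V : Set} where

    ⟦_⟧ᵀ : ∀ {D} → Term V D → (V → Carrier) → Carrier
    ⟦ term c μ _ ⟧ᵀ val = c * monomial μ val

    ⟦_⟧ᴾ : ∀ {D} → Poly V D → (V → Carrier) → Carrier
    ⟦ P ⟧ᴾ val = sumOver P (λ t → ⟦ t ⟧ᵀ val)

    constᴾ : ∀ {D} → Carrier → Poly V D
    constᴾ c = term c [] z≤n ∷ []

    varᴾ : V → Poly V 1
    varᴾ v = term 1# (v ∷ []) ℕP.≤-refl ∷ []

    weaken : ∀ {D E} → D ℕ.≤ E → Poly V D → Poly V E
    weaken D≤E = map (λ { (term c μ μ≤D) → term c μ (ℕP.≤-trans μ≤D D≤E) })

    _⊗_ : ∀ {D E} → Term V D → Term V E → Term V (D ℕ.+ E)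
    term c μ μ≤D ⊗ term c′ ν ν≤E =
      term (c * c′) (μ ++ ν) (≡.subst (ℕ._≤ _) (≡.sym (ListP.length-++ μ)) (ℕP.+-mono-≤ μ≤D ν≤E))

    _*ᴾ_ : ∀ {D E} → Poly V D → Poly V E → Poly V (D ℕ.+ E)
    P *ᴾ R = concatMap (λ t → map (t ⊗_) R) P

    sumᴾ : ∀ {D} k → (Fin k → Poly V D) → Poly V D
    sumᴾ zero    f = []
    sumᴾ (suc k) f = f zero ++ sumᴾ k (f ∘ suc)

    prodᴾ : ∀ {D} k → (Fin k → Poly V D) → Poly V (k ℕ.* D)
    prodᴾ zero    f = constᴾ 1#
    prodᴾ (suc k) f = f zero *ᴾ prodᴾ k (f ∘ suc)

    powᴾ : ∀ {D} → Poly V D → ∀ e → Poly V (e ℕ.* D)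
    powᴾ P zero    = constᴾ 1#
    powᴾ P (suc e) = P *ᴾ powᴾ P e

    module _ (val : V → Carrier) where

      ⟦const⟧ : ∀ {D} c → ⟦ constᴾ {D} c ⟧ᴾ val ≈ c
      ⟦const⟧ c = trans (+-identityʳ _) (*-identityʳ c)

      ⟦var⟧ : ∀ v → ⟦ varᴾ v ⟧ᴾ val ≈ val v
      ⟦var⟧ v = trans (+-identityʳ _) (trans (*-identityˡ _) (*-identityʳ _))

      ⟦weaken⟧ : ∀ {D E} (D≤E : D ℕ.≤ E) (P : Poly V D) →
                 ⟦ weaken D≤E P ⟧ᴾ val ≈ ⟦ P ⟧ᴾ val
      ⟦weaken⟧ D≤E P = reflexive (sumOver-map _ P _)

      ⟦++⟧ : ∀ {D} (P R : Poly V D) → ⟦ P ++ R ⟧ᴾ val ≈ ⟦ P ⟧ᴾ val + ⟦ R ⟧ᴾ val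
      ⟦++⟧ P R = sumOver-++ P R _

      ⟦⊗⟧ : ∀ {D E} (t : Term V D) (s : Term V E) → ⟦ t ⊗ s ⟧ᵀ val ≈ ⟦ t ⟧ᵀ val * ⟦ s ⟧ᵀ val
      ⟦⊗⟧ (term c μ _) (term c′ ν _) = begin
        (c * c′) * monomial (μ ++ ν) val                ≈⟨ *-congˡ (monomial-++ μ ν val) ⟩
        (c * c′) * (monomial μ val * monomial ν val)    ≈⟨ *-interchange c c′ _ _ ⟩
        (c * monomial μ val) * (c′ * monomial ν val)    ∎

      ⟦*⟧ : ∀ {D E} (P : Poly V D) (R : Poly V E) → ⟦ P *ᴾ R ⟧ᴾ val ≈ ⟦ P ⟧ᴾ val * ⟦ R ⟧ᴾ val
      ⟦*⟧ P R = sumOver-combinations P R _⊗_ (λ t → ⟦ t ⟧ᵀ val) (λ t → ⟦ t ⟧ᵀ val) (λ s → ⟦ s ⟧ᵀ val)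
                                     ⟦⊗⟧

      ⟦sum⟧ : ∀ {D} k (f : Fin k → Poly V D) → ⟦ sumᴾ k f ⟧ᴾ val ≈ ∑ F k (λ i → ⟦ f i ⟧ᴾ val)
      ⟦sum⟧ zero    f = refl
      ⟦sum⟧ (suc k) f = trans (⟦++⟧ (f zero) _) (+-congˡ (⟦sum⟧ k (f ∘ suc)))

      ⟦prod⟧ : ∀ {D} k (f : Fin k → Poly V D) → ⟦ prodᴾ k f ⟧ᴾ val ≈ ∏ F k (λ i → ⟦ f i ⟧ᴾ val)
      ⟦prod⟧ zero    f = ⟦const⟧ {0} 1#
      ⟦prod⟧ (suc k) f = trans (⟦*⟧ (f zero) _) (*-congˡ (⟦prod⟧ k (f ∘ suc)))

      ⟦pow⟧ : ∀ {D} (P : Poly V D) e → ⟦ powᴾ P e ⟧ᴾ val ≈ ⟦ P ⟧ᴾ val ^ e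
      ⟦pow⟧ P zero    = ⟦const⟧ {0} 1#
      ⟦pow⟧ P (suc e) = trans (⟦*⟧ P _) (*-congˡ (⟦pow⟧ P e))

  polynomial-sum : (G : Grid) → let open Grid G in
                   ∀ {D} (P : Poly Var D) → D ℕ.< dim ℕ.* q-1 →
                   sumOver points (λ p → ⟦ P ⟧ᴾ (coord p)) ≈ 0#
  polynomial-sum G P D<dim = trans (sumOver-swap points P _) (sumOver-vanishes P term-sum)
    where
    open Grid G
    term-sum : ∀ t → sumOver points (λ p → ⟦ t ⟧ᵀ (coord p)) ≈ 0#
    term-sum (term c μ μ≤D) = begin
      sumOver points (λ p → c * monomial μ (coord p))  ≈⟨ sumOver-*ˡ points c _ ⟩
      c * sumOver points (λ p → monomial μ (coord p))  ≈⟨ *-congˡ (monomial-sum μ (ℕP.≤-<-trans μ≤D D<dim)) ⟩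
      c * 0#                                           ≈⟨ zeroʳ c ⟩
      0#                                               ∎

  ∏-as-product : ∀ k (f : Fin k → Carrier) → ∏ F k f ≡ Πᶠ.sum f
  ∏-as-product zero    f = ≡.refl
  ∏-as-product (suc k) f = ≡.cong (f zero *_) (∏-as-product k (f ∘ suc))

  ∑-cong : ∀ k {f g : Fin k → Carrier} → (∀ i → f i ≈ g i) → ∑ F k f ≈ ∑ F k g
  ∑-cong zero    f≈g = refl
  ∑-cong (suc k) f≈g = +-cong (f≈g zero) (∑-cong k (f≈g ∘ suc))

  ∏-cong : ∀ k {f g : Fin k → Carrier} → (∀ i → f i ≈ g i) → ∏ F k f ≈ ∏ F k g
  ∏-cong zero    f≈g = refl
  ∏-cong (suc k) f≈g = *-cong (f≈g zero) (∏-cong k (f≈g ∘ suc))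

  ∏-^ : ∀ k (f : Fin k → Carrier) e → ∏ F k f ^ e ≈ ∏ F k (λ i → f i ^ e)
  ∏-^ zero    f e = 1^e e
    where
    1^e : ∀ e → 1# ^ e ≈ 1#
    1^e zero    = refl
    1^e (suc e) = trans (*-identityˡ _) (1^e e)
  ∏-^ (suc k) f e = trans (^-distrib-* (f zero) _ e) (*-congˡ (∏-^ k (f ∘ suc) e))

  ∏-vanishes : ∀ k (f : Fin k → Carrier) i → f i ≈ 0# → ∏ F k f ≈ 0#
  ∏-vanishes (suc k) f zero    f0≈0 = trans (*-congʳ f0≈0) (zeroˡ _)
  ∏-vanishes (suc k) f (suc i) fi≈0 = trans (*-congˡ (∏-vanishes k (f ∘ suc) i fi≈0)) (zeroʳ _)

  allNonzero-true : ∀ k (f : Fin k → Carrier) → allNonzero F k f ≡ true → ∀ i → f i ≉ 0#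
  allNonzero-true (suc k) f all≡true i with f zero ≟ 0#
  allNonzero-true (suc k) f ()       i       | yes _
  allNonzero-true (suc k) f all≡true zero    | no f0≉0 = f0≉0
  allNonzero-true (suc k) f all≡true (suc i) | no _    = allNonzero-true k (f ∘ suc) all≡true i

  allNonzero-false : ∀ k (f : Fin k → Carrier) → allNonzero F k f ≡ false → ∃ λ i → f i ≈ 0#
  allNonzero-false (suc k) f all≡false with f zero ≟ 0#
  ... | yes f0≈0 = zero , f0≈0
  ... | no  _    = let i , fi≈0 = allNonzero-false k (f ∘ suc) all≡false in suc i , fi≈0

  -- For q > 2 the integrand of the amplitude is a polynomial function:
  -- 1/∏ yᵢ = ∏ yᵢ^(q-2) when all yᵢ ≠ 0 (Fermat), and both sides vanish
  -- otherwise because q - 2 > 0.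
  integrand-as-power : ∀ {e} → q-1 ≡ suc (suc e) → ∀ k (y : Fin k → Carrier) →
                       (if allNonzero F k y then ∏ F k y ⁻¹ else 0#) ≈ ∏ F k (λ i → y i ^ suc e)
  integrand-as-power {e} q-1≡2+e k y with allNonzero F k y in all≡
  ... | true  = trans (⁻¹-unique ∏y≉0 ∏y^[q-1]≈1) (∏-^ k y (suc e))
    where
    ∏y≉0 : ∏ F k y ≉ 0#
    ∏y≉0 = ≡.subst (_≉ 0#) (≡.sym (∏-as-product k y)) (product-nonzero y (allNonzero-true k y all≡))
    ∏y^[q-1]≈1 : ∏ F k y * ∏ F k y ^ suc e ≈ 1#
    ∏y^[q-1]≈1 = ≡.subst (λ m → ∏ F k y ^ m ≈ 1#) q-1≡2+e (fermat fieldEnumeration _ ∏y≉0)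
  ... | false = let i , yi≈0 = allNonzero-false k y all≡ in
                sym (∏-vanishes k (λ i → y i ^ suc e) i (trans (*-congʳ yi≈0) (zeroˡ _)))

  -- The loop momenta p ∈ F^(d·h₁), listed exactly as in the amplitude.
  momentumGrid : ℕ → ℕ → Grid
  momentumGrid h₁ d = (lineGrid ^ᴳ d) ^ᴳ h₁

  momentumᴾ : ∀ {n h₁ d} → (Fin n → Fin h₁ → Sign) → Fin n → Fin d →
              Poly (Grid.Var (momentumGrid h₁ d)) 1
  momentumᴾ {h₁ = h₁} ε i t = sumᴾ h₁ (λ j → constᴾ {D = 0} (⟦_⟧ F (ε i j)) *ᴾ varᴾ (j , t , tt))

  ⟦momentum⟧ : ∀ {n h₁ d} (ε : Fin n → Fin h₁ → Sign) p i t →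
               ⟦ momentumᴾ ε i t ⟧ᴾ (Grid.coord (momentumGrid h₁ d) p) ≈ momentum F ε p i t
  ⟦momentum⟧ {h₁ = h₁} {d} ε p i t = trans (⟦sum⟧ val h₁ _) (∑-cong h₁ (λ j →
    trans (⟦*⟧ val (constᴾ {D = 0} (⟦_⟧ F (ε i j))) (varᴾ (j , t , tt)))
          (*-cong (⟦const⟧ val {0} (⟦_⟧ F (ε i j))) (⟦var⟧ val (j , t , tt)))))
    where
    val : Fin h₁ × Fin d × ⊤ → Carrier
    val = Grid.coord (momentumGrid h₁ d) p

  quadricᴾ : ∀ {V : Set} {d} → Quadric F d → (Fin d → Poly V 1) → Poly V 2
  quadricᴾ {d = d} Q L =
    (sumᴾ d (λ j → sumᴾ d (λ l → (constᴾ {D = 0} (a j l) *ᴾ L j) *ᴾ L l))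
      ++ weaken (s≤s z≤n) (sumᴾ d (λ j → constᴾ {D = 0} (b j) *ᴾ L j)))
    ++ constᴾ c
    where open Quadric Q

  ⟦quadric⟧ : ∀ {V : Set} {d} (Q : Quadric F d) (L : Fin d → Poly V 1) val {y : Fin d → Carrier} →
              (∀ t → ⟦ L t ⟧ᴾ val ≈ y t) → ⟦ quadricᴾ Q L ⟧ᴾ val ≈ evalQ F Q y
  ⟦quadric⟧ {V} {d} Q L val {y} L≈y = begin
    ⟦ (quadratic ++ weaken (s≤s z≤n) linear) ++ constᴾ c ⟧ᴾ val
      ≈⟨ trans (⟦++⟧ val (quadratic ++ weaken (s≤s z≤n) linear) (constᴾ c))
               (+-congʳ (⟦++⟧ val quadratic (weaken (s≤s z≤n) linear))) ⟩
    (⟦ quadratic ⟧ᴾ val + ⟦ weaken (s≤s z≤n) linear ⟧ᴾ val) + ⟦ constᴾ {D = 2} c ⟧ᴾ val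
      ≈⟨ +-cong (+-cong quadratic-part (trans (⟦weaken⟧ val (s≤s z≤n) linear) linear-part))
                (⟦const⟧ val {2} c) ⟩
    evalQ F Q y ∎
    where
    open Quadric Q
    ⟦scaled⟧ : ∀ x t → ⟦ constᴾ {D = 0} x *ᴾ L t ⟧ᴾ val ≈ x * y t
    ⟦scaled⟧ x t = trans (⟦*⟧ val (constᴾ {D = 0} x) (L t)) (*-cong (⟦const⟧ val {0} x) (L≈y t))
    quadratic : Poly V 2
    quadratic = sumᴾ d (λ j → sumᴾ d (λ l → (constᴾ {D = 0} (a j l) *ᴾ L j) *ᴾ L l))
    linear : Poly V 1
    linear = sumᴾ d (λ j → constᴾ {D = 0} (b j) *ᴾ L j)
    quadratic-part : ⟦ quadratic ⟧ᴾ val ≈ ∑ F d (λ j → ∑ F d (λ l → a j l * y j * y l))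
    quadratic-part = trans (⟦sum⟧ val d _) (∑-cong d (λ j → trans (⟦sum⟧ val d _) (∑-cong d (λ l →
      trans (⟦*⟧ val (constᴾ {D = 0} (a j l) *ᴾ L j) (L l)) (*-cong (⟦scaled⟧ (a j l) j) (L≈y l))))))
    linear-part : ⟦ linear ⟧ᴾ val ≈ ∑ F d (λ j → b j * y j)
    linear-part = trans (⟦sum⟧ val d _) (∑-cong d (λ j → ⟦scaled⟧ (b j) j))

  amplitude-vanishes : ∀ {e} → q-1 ≡ suc (suc e) →
                       ∀ n h₁ d (ε : Fin n → Fin h₁ → Sign) (Q : Quadric F d) →
                       n ℕ.* (suc e ℕ.* 2) ℕ.< (d ℕ.* h₁) ℕ.* q-1 → feynmanAmp F n h₁ d ε Q ≈ 0#
  amplitude-vanishes {e} q-1≡2+e n h₁ d ε Q degree< = begin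
    feynmanAmp F n h₁ d ε Q
      ≈⟨ sumOver-cong points (λ p → trans (integrand-as-power q-1≡2+e n (Qᵢ F Q ε p)) (sym (⟦integrand⟧ p))) ⟩
    sumOver points (λ p → ⟦ integrandᴾ ⟧ᴾ (coord p))
      ≈⟨ polynomial-sum (momentumGrid h₁ d) integrandᴾ
           (≡.subst (λ N → n ℕ.* (suc e ℕ.* 2) ℕ.< N ℕ.* q-1) dh₁≡dim degree<) ⟩
    0# ∎
    where
    open Grid (momentumGrid h₁ d)
    dh₁≡dim : d ℕ.* h₁ ≡ h₁ ℕ.* (d ℕ.* 1)
    dh₁≡dim = ≡.trans (ℕP.*-comm d h₁) (≡.cong (h₁ ℕ.*_) (≡.sym (ℕP.*-identityʳ d)))
    integrandᴾ : Poly Var (n ℕ.* (suc e ℕ.* 2))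
    integrandᴾ = prodᴾ n (λ i → powᴾ (quadricᴾ Q (momentumᴾ ε i)) (suc e))
    ⟦integrand⟧ : ∀ p → ⟦ integrandᴾ ⟧ᴾ (coord p) ≈ ∏ F n (λ i → Qᵢ F Q ε p i ^ suc e)
    ⟦integrand⟧ p = trans (⟦prod⟧ (coord p) n _) (∏-cong n (λ i →
      trans (⟦pow⟧ (coord p) (quadricᴾ Q (momentumᴾ ε i)) (suc e))
            (^-congˡ (suc e) (⟦quadric⟧ Q (momentumᴾ ε i) (coord p) (⟦momentum⟧ ε p i)))))

open import Data.Integer using (+_; _+_; _-_; _*_; _<_)
import Data.Integer.Properties as ℤP
open import Data.Integer.Tactic.RingSolver using (solve-∀)
open FiniteField using (size; _≈_; 0#)

-- With q - 1 = e + 2, the hypothesis (q - 1)·c + 2n > 0 on the superficial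
-- degree of divergence c = N - 2n says exactly that 2n(q - 2) < N(q - 1),
-- because N(q - 1) = 2n(q - 2) + ((q - 1)·c + 2n).
degree-bound : ∀ e n N → + 0 < + suc (suc e) * (+ N - + (2 ℕ.* n)) + + (2 ℕ.* n) →
               n ℕ.* (suc e ℕ.* 2) ℕ.< N ℕ.* suc (suc e)
degree-bound e n N 0<X = ℤP.drop‿+<+ (begin-strict
  + L                         ≡⟨ ℤP.+-identityʳ (+ L) ⟨
  + L + + 0                   <⟨ ℤP.+-monoʳ-< (+ L) 0<X ⟩
  + L + X                     ≡⟨ splitting ⟨
  + (N ℕ.* suc (suc e))       ∎)
  where
  open ℤP.≤-Reasoning
  L : ℕ
  L = n ℕ.* (suc e ℕ.* 2)
  X : Data.Integer.ℤ
  X = + suc (suc e) * (+ N - + (2 ℕ.* n)) + + (2 ℕ.* n)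
  ring-identity : ∀ N n e →
                  N * (+ 2 + e) ≡ n * ((+ 1 + e) * + 2) + ((+ 2 + e) * (N - + 2 * n) + + 2 * n)
  ring-identity = solve-∀
  splitting : + (N ℕ.* suc (suc e)) ≡ + L + X
  splitting = begin-equality
    + (N ℕ.* suc (suc e))
      ≡⟨ ℤP.pos-* N (2 ℕ.+ e) ⟩
    + N * + (2 ℕ.+ e)
      ≡⟨ ≡.cong (+ N *_) (ℤP.pos-+ 2 e) ⟩
    + N * (+ 2 + + e)
      ≡⟨ ring-identity (+ N) (+ n) (+ e) ⟩
    + n * ((+ 1 + + e) * + 2) + ((+ 2 + + e) * (+ N - + 2 * + n) + + 2 * + n)
      ≡⟨ ≡.cong₂ _+_ L≡ (≡.cong₂ _+_ (≡.cong₂ _*_ (ℤP.pos-+ 2 e) (≡.cong (+ N -_) (ℤP.pos-* 2 n)))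
                                     (ℤP.pos-* 2 n)) ⟨
    + L + X ∎
    where
    L≡ : + L ≡ + n * ((+ 1 + + e) * + 2)
    L≡ = ≡.trans (ℤP.pos-* n (suc e ℕ.* 2))
                 (≡.cong (+ n *_) (≡.trans (ℤP.pos-* (suc e) 2) (≡.cong (_* + 2) (ℤP.pos-+ 1 e))))

lemma4 : (F : FiniteField) → size F ℕ.> 2 →
         (n h₁ d : ℕ) → h₁ ℕ.> 0 → d ℕ.> 0 →
         (ε : Fin n → Fin h₁ → Sign) → (Q : Quadric F d) →
         + 0 < (+ (size F ℕ.∸ 1)) * (+ (d ℕ.* h₁) - + (2 ℕ.* n)) + + (2 ℕ.* n) →
         _≈_ F (feynmanAmp F n h₁ d ε Q) (0# F)
lemma4 F q>2 n h₁ d _ _ ε Q divergence-bound =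
  amplitude-vanishes F q-1≡2+e n h₁ d ε Q
    (≡.subst (λ m → n ℕ.* (suc e ℕ.* 2) ℕ.< (d ℕ.* h₁) ℕ.* m) (≡.sym q-1≡2+e)
      (degree-bound e n (d ℕ.* h₁)
        (≡.subst (λ m → + 0 < + m * (+ (d ℕ.* h₁) - + (2 ℕ.* n)) + + (2 ℕ.* n)) q-1≡2+e divergence-bound)))
  where
  e : ℕ
  e = proj₁ (ℕP.m≤n⇒∃[o]m+o≡n q>2)
  q-1≡2+e : size F ℕ.∸ 1 ≡ suc (suc e)
  q-1≡2+e = ≡.cong (ℕ._∸ 1) (≡.sym (proj₂ (ℕP.m≤n⇒∃[o]m+o≡n q>2)))
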